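{- Let $N=(\mathscr S,\mathscr C,\mathscr R)$ be a 0,1-network with reactions $y_1\to y_1',\dots,y_m\to y_m'$, and suppose the vertex $v_i$ of $\mathcal H_N$ is almost balanced with respect to a 2-colored multiset $\mathscr E=\mathscr E_r\sqcup\mathscr E_b$ over the edges of $\mathcal H_N$. Let $N'=N\cup\{y_i\to\varnothing\}$ be obtained by adding the reaction $y_i\to\varnothing$ with a new rate constant $\kappa_i'$. If the reaction hyperedge $E_i$ does not belong to $\mathscr E$, then $\mathcal I(N')=\mathcal I(N)$.
   Context: A chemical reaction network $N=(\mathscr S,\mathscr C,\mathscr R)$ consists of a finite set of species $\mathscr S$, a finite set of complexes $\mathscr C\subseteq\mathbb Z_{\ge0}^{\mathscr S}$, and a finite set of reactions $\mathscr R$, each written $y\to y'$ with $y,y'\in\mathscr C$, $y\ne y'$; every complex occurs in some reaction, every species lies in the support of some complex, and there are no reactions of the form $\varnothing\to y$ ($\varnothing$ denotes the zero complex). Reactions are indexed $1,\dots,m$, the $i$-th written $y_i\to y_i'$ with rate constant $\kappa_i$. $N$ is a 0,1-network if every complex lies in $\{0,1\}^{\mathscr S}$. $x^y=\prod_s x_s^{y_s}$. The steady-state polynomial of species $s$ is $\dot x_s=\sum_i\kappa_i x^{y_i}(y'_{i,s}-y_{i,s})\in\mathbb K(\kappa)[x]$, with the $\kappa_i$ indeterminates and $\mathbb K$ a field of characteristic zero (the paper uses $\mathbb Q$); the steady-state ideal is $\mathcal I(N)=\langle\dot x_s: s\in\mathscr S\rangle$. $\mathcal I(N)$ and $\mathcal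 I(N')$ are compared as ideals of the common ring $\mathbb K(\kappa_1,\dots,\kappa_m,\kappa_i')[x_s: s\in\mathscr S]$. The network hypergraph $\mathcal H_N$ has $2m$ vertices $u_1,v_1,\dots,u_m,v_m$ ($u_i$ represents the reactant $y_i$ of reaction $i$, $v_i$ its product $y_i'$). Hyperedges: for each species $s$, $E_s=\{u_i: s\in\mathrm{supp}(y_i)\}\cup\{v_i: s\in\mathrm{supp}(y_i')\}$; for each reaction $i$, $E_i=\{u_i,v_i\}$ if $y_i'\ne\varnothing$ and $E_i=\varnothing$ otherwise. A multiset $\mathscr E$ over the edges assigns nonnegative multiplicities; an edge belongs to $\mathscr E$ if its multiplicity is positive. A 2-coloring $\mathscr E=\mathscr E_r\sqcup\mathscr E_b$ splits $\mathscr E$ into two submultisets whose multiplicities add to those of $\mathscr E$. $\deg_{\mathscr E_c}(w)$ is the number of edges of $\mathscr E_c$, counted with multiplicity, containing $w$. A vertex $w$ is almost balanced with respect to the 2-coloring if $\deg_{\mathscr E_r}(w)=\deg_{\mathscr E_b}(w)+k$ for some positive integer $k$ and $\deg_{\mathscr E_r}(z)=\deg_{\mathscr E_b}(z)$ for every other vertex $z$. -}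

module Defs where

open import Data.Nat as ℕ using (ℕ; zero; suc; _≤_; _<_)
open import Data.Integer as ℤ using (ℤ; +_)
open import Data.Rational as ℚ using (ℚ; 0ℚ; 1ℚ)
open import Data.Rational.Properties as ℚP using ()
open import Data.Fin as Fin using (Fin)
open import Data.Fin.Properties as FinP using ()
open import Data.Vec as Vec using (Vec; lookup; replicate; zipWith)
open import Data.Vec.Properties as VecP using ()
open import Data.List as List using (List; []; _∷_; _++_; concat; allFin)
open import Data.Bool using (Bool; true; false; _∧_; if_then_else_)
open import Data.Sum using (_⊎_; inj₁; inj₂)
open import Data.Product using (Σ; ∃; _×_; _,_; proj₁; proj₂)
open import Relation.Nullary using (¬_; Dec; yes; no; does)
open import Relation.Binary.PropositionalEquality using (_≡_; _≢_)
open import Relation.Binary.Definitions using (DecidableEquality)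

Complex : ℕ → Set
Complex n = Vec ℕ n

zeroC : ∀ {n} → Complex n
zeroC {n} = replicate n 0

record Network (n m : ℕ) : Set where
  field
    reactant : Fin m → Complex n
    product  : Fin m → Complex n
open Network public

-- Standing assumptions on a reaction network (the complex set is the set of
-- complexes occurring in reactions, so "every complex occurs in a reaction"
-- holds by construction).
record IsNetwork {n m : ℕ} (N : Network n m) : Set where
  field
    distinct    : ∀ i j → reactant N i ≡ reactant N j → product N i ≡ product N j → i ≡ j
    nonTrivial  : ∀ i → reactant N i ≢ product N i
    noInflow    : ∀ i → reactant N i ≢ zeroC
    speciesUsed : ∀ s → ∃ λ i → (lookup (reactant N i) s ≢ 0) ⊎ (lookup (product N i) s ≢ 0)

Is01 : ∀ {n m} → Network n m → Set
Is01 {n} {m} N = ∀ (i : Fin m) (s : Fin n) → lookup (reactant N i) s ≤ 1 × lookup (product N i) s ≤ 1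

addOutflow : ∀ {n m} → Network n m → Fin m → Network n (suc m)
reactant (addOutflow N i) Fin.zero    = reactant N i
reactant (addOutflow N i) (Fin.suc j) = reactant N j
product  (addOutflow N i) Fin.zero    = zeroC
product  (addOutflow N i) (Fin.suc j) = product N j

-- Polynomials in ℚ[κ_0,…,κ_{r-1}, x_0,…,x_{n-1}]
-- (r rate-constant indeterminates, n species variables).

record Mono (r n : ℕ) : Set where
  constructor mono
  field
    kexp : Vec ℕ r
    xexp : Vec ℕ n
open Mono public

_≟M_ : ∀ {r n} → DecidableEquality (Mono r n)
mono a b ≟M mono c d with VecP.≡-dec ℕ._≟_ a c | VecP.≡-dec ℕ._≟_ b d
... | yes Relation.Binary.PropositionalEquality.refl | yes Relation.Binary.PropositionalEquality.refl = yes Relation.Binary.PropositionalEquality.refl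
... | no p  | _     = no λ { Relation.Binary.PropositionalEquality.refl → p Relation.Binary.PropositionalEquality.refl }
... | yes _ | no q  = no λ { Relation.Binary.PropositionalEquality.refl → q Relation.Binary.PropositionalEquality.refl }

_·M_ : ∀ {r n} → Mono r n → Mono r n → Mono r n
mono a b ·M mono c d = mono (zipWith ℕ._+_ a c) (zipWith ℕ._+_ b d)

Poly : ℕ → ℕ → Set
Poly r n = List (ℚ × Mono r n)

coeff : ∀ {r n} → Poly r n → Mono r n → ℚ
coeff []             μ = 0ℚ
coeff ((a , ν) ∷ p) μ = (if does (ν ≟M μ) then a else 0ℚ) ℚ.+ coeff p μ

_≈P_ : ∀ {r n} → Poly r n → Poly r n → Set
p ≈P q = ∀ μ → coeff p μ ≡ coeff q μ

_+P_ : ∀ {r n} → Poly r n → Poly r n → Poly r n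
_+P_ = _++_

_*P_ : ∀ {r n} → Poly r n → Poly r n → Poly r n
p *P q = concat (List.map (λ { (a , μ) → List.map (λ { (b , ν) → (a ℚ.* b , μ ·M ν) }) q }) p)

ΣP : ∀ {r n k} → (Fin k → Poly r n) → Poly r n
ΣP {k = k} f = concat (List.map f (allFin k))

unitV : ∀ {k} → Fin k → Vec ℕ k
unitV j = Vec.tabulate (λ l → if does (j FinP.≟ l) then 1 else 0)

ℕtoℚ : ℕ → ℚ
ℕtoℚ a = (+ a) ℚ./ 1

-- Steady-state polynomials.  The rate constant of reaction j is the
-- indeterminate κ_{ρ j}, for an assignment ρ of reactions to κ-variables.
-- ẋ_s = Σ_j κ_{ρ j} x^{y_j} (y'_{j,s} − y_{j,s})

xdot : ∀ {r n m} → Network n m → (Fin m → Fin r) → Fin n → Poly r n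
xdot {m = m} N ρ s = ΣP {k = m} λ j →
  (ℕtoℚ (lookup (product N j) s) ℚ.- ℕtoℚ (lookup (reactant N j) s)
    , mono (unitV (ρ j)) (reactant N j)) ∷ []

-- An element of ℚ(κ)[x] is p/c with p ∈ ℚ[κ,x] and 0 ≠ c ∈ ℚ[κ]; it lies in the
-- ideal of ℚ(κ)[x] generated by g_1,…,g_n ∈ ℚ[κ,x] iff its numerator p does,
-- iff (clearing denominators) d·p = Σ_s h_s g_s for some nonzero d ∈ ℚ[κ]
-- and some h_s ∈ ℚ[κ,x].

KappaOnly : ∀ {r n} → Poly r n → Set
KappaOnly d = ∀ μ → xexp μ ≢ zeroC → coeff d μ ≡ 0ℚ

NonZeroP : ∀ {r n} → Poly r n → Set
NonZeroP d = ¬ (∀ μ → coeff d μ ≡ 0ℚ)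

InIdeal : ∀ {r n} → (Fin n → Poly r n) → Poly r n → Set
InIdeal {r} {n} g p =
  Σ (Poly r n) λ d → KappaOnly d × NonZeroP d ×
    Σ (Fin n → Poly r n) λ h → (d *P p) ≈P ΣP (λ s → h s *P g s)

-- equality of the ideals generated by g and g' in ℚ(κ)[x]
-- (tested on numerators p ∈ ℚ[κ,x], which suffices since denominators are units)
SameIdeal : ∀ {r n} → (Fin n → Poly r n) → (Fin n → Poly r n) → Set
SameIdeal {r} {n} g g' = ∀ (p : Poly r n) → (InIdeal g p → InIdeal g' p) × (InIdeal g' p → InIdeal g p)

-- Common ring ℚ(κ_0,κ_1,…,κ_m)[x]: κ_0 plays the role of κ_i' and
-- κ_{suc j} is the rate constant of reaction j of N.
-- I(N):  generators ẋ_s of N (reaction j has rate κ_{suc j})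
ssN : ∀ {n m} → Network n m → Fin n → Poly (suc m) n
ssN N = xdot N Fin.suc

ssN' : ∀ {n m} → Network n m → Fin m → Fin n → Poly (suc m) n
ssN' N i = xdot (addOutflow N i) (λ k → k)

-- The network hypergraph H_N.
-- Vertices: inj₁ j = u_j (reactant of reaction j), inj₂ j = v_j (product).
-- Edge indices: inj₁ s = species edge E_s, inj₂ j = reaction edge E_j.

Vertex : ℕ → Set
Vertex m = Fin m ⊎ Fin m

EdgeIx : ℕ → ℕ → Set
EdgeIx n m = Fin n ⊎ Fin m

nz : ℕ → Bool
nz zero    = false
nz (suc _) = true

isNonZeroC : ∀ {n} → Complex n → Bool
isNonZeroC y = does (Relation.Nullary.¬? (VecP.≡-dec ℕ._≟_ y zeroC))

memb : ∀ {n m} → Network n m → EdgeIx n m → Vertex m → Bool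
memb N (inj₁ s) (inj₁ j) = nz (lookup (reactant N j) s)
memb N (inj₁ s) (inj₂ j) = nz (lookup (product N j) s)
memb N (inj₂ k) (inj₁ j) = isNonZeroC (product N k) ∧ does (k FinP.≟ j)
memb N (inj₂ k) (inj₂ j) = isNonZeroC (product N k) ∧ does (k FinP.≟ j)

∑ : ∀ k → (Fin k → ℕ) → ℕ
∑ zero    f = 0
∑ (suc k) f = f Fin.zero ℕ.+ ∑ k (λ j → f (Fin.suc j))

Multiset : ℕ → ℕ → Set
Multiset n m = EdgeIx n m → ℕ

deg : ∀ {n m} → Network n m → Multiset n m → Vertex m → ℕ
deg {n} {m} N E w =
  ∑ n (λ s → E (inj₁ s) ℕ.* (if memb N (inj₁ s) w then 1 else 0)) ℕ.+
  ∑ m (λ j → E (inj₂ j) ℕ.* (if memb N (inj₂ j) w then 1 else 0))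

AlmostBalanced : ∀ {n m} → Network n m → Multiset n m → Multiset n m → Vertex m → Set
AlmostBalanced {n} {m} N Er Eb w =
  (Σ ℕ λ k → 0 < k × deg N Er w ≡ deg N Eb w ℕ.+ k) ×
  (∀ z → z ≢ w → deg N Er z ≡ deg N Eb z)

SameEdge : ∀ {n m} → Network n m → EdgeIx n m → EdgeIx n m → Set
SameEdge N e e' = ∀ w → memb N e w ≡ memb N e' w

EdgeNotIn : ∀ {n m} → Network n m → Multiset n m → Multiset n m → Fin m → Set
EdgeNotIn N Er Eb i = ∀ e → SameEdge N e (inj₂ i) → Er e ℕ.+ Eb e ≡ 0

module Submission where

-- Put a_s = mult_r(E_s) − mult_b(E_s) for the species edges. In a 0,1-network the species edges
-- through u_j (resp. v_j) are those of the species of y_j (resp. y_j'), and u_j, v_j lie in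
-- the same reaction edges, so balance at u_j and at v_j (almost balance, with excess k, at v_i)
-- gives  Σ_s a_s (y'_{j,s} − y_{j,s}) = k·[j = i],  i.e.  Σ_s a_s ẋ_s = k κ_i x^{y_i}.
-- Balance at u_i, where E_i contributes nothing, gives Σ_s a_s y_{i,s} = 0, so the same
-- combination of the generators of N' is also k κ_i x^{y_i}. As ẋ'_s = ẋ_s − y_{i,s} κ_i' x^{y_i},
-- the generators of either ideal differ from those of the other by multiples of
-- κ_i' x^{y_i} = (κ_i' / (k κ_i)) Σ_s a_s ẋ_s, which lies in both ideals over ℚ(κ);
-- clearing the denominator k κ_i gives explicit cofactors.

open import Defs

open import Algebra.Bundles using (CommutativeMonoid; CommutativeSemiring; CommutativeRing)
import Algebra.Properties.CommutativeSemigroup as CommutativeSemigroupProperties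
import Algebra.Properties.Ring
import Algebra.Properties.Semiring.Sum
open import Algebra.Structures using (IsCommutativeMonoid)
open import Algebra.Structures.Biased using (IsCommutativeSemiringˡ)
open import Data.Bool using (true; false; if_then_else_)
import Data.Bool.Properties as BoolP
open import Data.Empty using (⊥-elim)
open import Data.Fin as Fin using (Fin)
import Data.Fin.Properties as FinP
import Data.Integer as ℤ
import Data.Integer.Properties as ℤP
open import Data.List as List using ([]; _∷_; _++_; concat)
import Data.List.Properties as ListP
open import Data.Nat as ℕ using (ℕ; _≤_)
open import Data.Nat.Coprimality using (1-coprimeTo)
import Data.Nat.Coprimality as Coprime
import Data.Nat.Properties as ℕP
open import Data.Product using (∃; _×_; _,_; proj₁; proj₂)
open import Data.Rational as ℚ using (ℚ; 0ℚ; 1ℚ; mkℚ)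
import Data.Rational.Properties as ℚP
open import Data.Rational.Solver using (module +-*-Solver)
open import Data.Sum using (inj₁; inj₂)
open import Data.Vec as Vec using (Vec; zipWith; replicate; lookup)
open import Data.Vec.Functional using (Vector; removeAt)
import Data.Vec.Properties as VecP
open import Function using (_∘_)
open import Level using (0ℓ)
open import Relation.Binary.Bundles using (Setoid)
open import Relation.Binary.PropositionalEquality
  using (_≡_; _≢_; refl; sym; trans; cong; cong₂; module ≡-Reasoning)
import Relation.Binary.Reasoning.Setoid as SetoidReasoning
open import Relation.Binary.Structures using (IsEquivalence)
open import Relation.Nullary using (¬_; Dec; yes; no; does)

zipWith-+-cancelˡ : ∀ {k} (a b c : Vec ℕ k) → zipWith ℕ._+_ a b ≡ zipWith ℕ._+_ a c → b ≡ c
zipWith-+-cancelˡ Vec.[] Vec.[] Vec.[] _ = refl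
zipWith-+-cancelˡ (x Vec.∷ a) (y Vec.∷ b) (z Vec.∷ c) eq =
  cong₂ Vec._∷_ (ℕP.+-cancelˡ-≡ x y z (cong Vec.head eq)) (zipWith-+-cancelˡ a b c (cong Vec.tail eq))

zipWith-+-∸ : ∀ {k} (a b : Vec ℕ k) → zipWith ℕ._∸_ (zipWith ℕ._+_ a b) a ≡ b
zipWith-+-∸ Vec.[] Vec.[] = refl
zipWith-+-∸ (x Vec.∷ a) (y Vec.∷ b) = cong₂ Vec._∷_ (ℕP.m+n∸m≡n x y) (zipWith-+-∸ a b)

-- c ∸ a is the only candidate quotient.
zipWith-+-divides? : ∀ {k} (a c : Vec ℕ k) → Dec (∃ λ b → zipWith ℕ._+_ a b ≡ c)
zipWith-+-divides? a c with VecP.≡-dec ℕ._≟_ (zipWith ℕ._+_ a (zipWith ℕ._∸_ c a)) c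
... | yes eq = yes (_ , eq)
... | no neq = no λ { (b , refl) → neq (cong (zipWith ℕ._+_ a) (zipWith-+-∸ a b)) }

module _ {r n : ℕ} where

  oneM : Mono r n
  oneM = mono (replicate r 0) zeroC

  _∣M_ : Mono r n → Mono r n → Set
  μ ∣M ρ = ∃ λ ν → μ ·M ν ≡ ρ

  ·M-comm : (μ ν : Mono r n) → μ ·M ν ≡ ν ·M μ
  ·M-comm (mono a b) (mono c d) = cong₂ mono (VecP.zipWith-comm ℕP.+-comm a c) (VecP.zipWith-comm ℕP.+-comm b d)

  ·M-assoc : (μ ν ρ : Mono r n) → (μ ·M ν) ·M ρ ≡ μ ·M (ν ·M ρ)
  ·M-assoc (mono a b) (mono c d) (mono e f) = cong₂ mono (VecP.zipWith-assoc ℕP.+-assoc a c e) (VecP.zipWith-assoc ℕP.+-assoc b d f)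

  ·M-identityˡ : (μ : Mono r n) → oneM ·M μ ≡ μ
  ·M-identityˡ (mono a b) = cong₂ mono (VecP.zipWith-identityˡ ℕP.+-identityˡ a) (VecP.zipWith-identityˡ ℕP.+-identityˡ b)

  ·M-cancelˡ : (μ ν ρ : Mono r n) → μ ·M ν ≡ μ ·M ρ → ν ≡ ρ
  ·M-cancelˡ (mono a b) (mono c d) (mono e f) eq =
    cong₂ mono (zipWith-+-cancelˡ a c e (cong kexp eq)) (zipWith-+-cancelˡ b d f (cong xexp eq))

  _∣M?_ : (μ ρ : Mono r n) → Dec (μ ∣M ρ)
  mono a b ∣M? mono c d with zipWith-+-divides? a c | zipWith-+-divides? b d
  ... | yes (e , refl) | yes (f , refl) = yes (mono e f , refl)
  ... | no ∤ | _ = no λ { (ν , eq) → ∤ (kexp ν , cong kexp eq) }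
  ... | yes _ | no ∤ = no λ { (ν , eq) → ∤ (xexp ν , cong xexp eq) }

  ·M-≟-cancelˡ : (μ ν ρ : Mono r n) → does ((μ ·M ν) ≟M (μ ·M ρ)) ≡ does (ν ≟M ρ)
  ·M-≟-cancelˡ μ ν ρ with (μ ·M ν) ≟M (μ ·M ρ) | ν ≟M ρ
  ... | yes _  | yes _  = refl
  ... | no _   | no _   = refl
  ... | yes eq | no neq = ⊥-elim (neq (·M-cancelˡ μ ν ρ eq))
  ... | no neq | yes eq = ⊥-elim (neq (cong (μ ·M_) eq))

-- Polynomials modulo _≈P_ form a commutative semiring

module _ {r n : ℕ} where

  Term : Set
  Term = ℚ × Mono r n

  _⊗_ : Term → Term → Term
  (a , μ) ⊗ (b , ν) = (a ℚ.* b , μ ·M ν)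

  -- coeff (t ∷ p) μ and (t ∷ p) *P q reduce to termCoeff t μ ℚ.+ coeff p μ and termMul t q ++ p *P q.
  termCoeff : Term → Mono r n → ℚ
  termCoeff (a , ν) μ = if does (ν ≟M μ) then a else 0ℚ

  termMul : Term → Poly r n → Poly r n
  termMul t = List.map (t ⊗_)

  coeff-++ : ∀ (p q : Poly r n) μ → coeff (p ++ q) μ ≡ coeff p μ ℚ.+ coeff q μ
  coeff-++ [] q μ = sym (ℚP.+-identityˡ _)
  coeff-++ (t ∷ p) q μ = trans (cong (termCoeff t μ ℚ.+_) (coeff-++ p q μ)) (sym (ℚP.+-assoc (termCoeff t μ) _ _))

  coeff-termMul-· : ∀ a μ ν (q : Poly r n) → coeff (termMul (a , μ) q) (μ ·M ν) ≡ a ℚ.* coeff q ν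
  coeff-termMul-· a μ ν [] = sym (ℚP.*-zeroʳ a)
  coeff-termMul-· a μ ν ((b , ν′) ∷ q) = begin
    (if does ((μ ·M ν′) ≟M (μ ·M ν)) then a ℚ.* b else 0ℚ) ℚ.+ coeff (termMul (a , μ) q) (μ ·M ν)
      ≡⟨ cong₂ ℚ._+_ (cong (λ d → if d then a ℚ.* b else 0ℚ) (·M-≟-cancelˡ μ ν′ ν)) (coeff-termMul-· a μ ν q) ⟩
    (if does (ν′ ≟M ν) then a ℚ.* b else 0ℚ) ℚ.+ a ℚ.* coeff q ν
      ≡⟨ cong (ℚ._+ _) (pull (does (ν′ ≟M ν))) ⟩
    a ℚ.* (if does (ν′ ≟M ν) then b else 0ℚ) ℚ.+ a ℚ.* coeff q ν
      ≡⟨ sym (ℚP.*-distribˡ-+ a _ _) ⟩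
    a ℚ.* coeff ((b , ν′) ∷ q) ν ∎
    where
    open ≡-Reasoning
    pull : ∀ d → (if d then a ℚ.* b else 0ℚ) ≡ a ℚ.* (if d then b else 0ℚ)
    pull true  = refl
    pull false = sym (ℚP.*-zeroʳ a)

  coeff-termMul-∤ : ∀ a μ ρ (q : Poly r n) → ¬ μ ∣M ρ → coeff (termMul (a , μ) q) ρ ≡ 0ℚ
  coeff-termMul-∤ a μ ρ [] _ = refl
  coeff-termMul-∤ a μ ρ ((b , ν) ∷ q) ∤ with (μ ·M ν) ≟M ρ
  ... | yes eq = ⊥-elim (∤ (ν , eq))
  ... | no _   = trans (ℚP.+-identityˡ _) (coeff-termMul-∤ a μ ρ q ∤)

  termMul-cong : ∀ t (q q′ : Poly r n) → q ≈P q′ → termMul t q ≈P termMul t q′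
  termMul-cong (a , μ) q q′ q≈q′ ρ with μ ∣M? ρ
  ... | yes (ν , refl) = trans (coeff-termMul-· a μ ν q) (trans (cong (a ℚ.*_) (q≈q′ ν)) (sym (coeff-termMul-· a μ ν q′)))
  ... | no ∤ = trans (coeff-termMul-∤ a μ ρ q ∤) (sym (coeff-termMul-∤ a μ ρ q′ ∤))

  ≈P-isEquivalence : IsEquivalence (_≈P_ {r} {n})
  ≈P-isEquivalence = record
    { refl  = λ _ → refl
    ; sym   = λ p≈q μ → sym (p≈q μ)
    ; trans = λ p≈q q≈s μ → trans (p≈q μ) (q≈s μ)
    }

  ≡⇒≈P : {p q : Poly r n} → p ≡ q → p ≈P q
  ≡⇒≈P refl _ = refl

  -- _≈P_ is a function type, from which Agda cannot infer the polynomials: they are explicit.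
  ++-cong : (p p′ q q′ : Poly r n) → p ≈P p′ → q ≈P q′ → (p ++ q) ≈P (p′ ++ q′)
  ++-cong p p′ q q′ p≈p′ q≈q′ μ =
    trans (coeff-++ p q μ) (trans (cong₂ ℚ._+_ (p≈p′ μ) (q≈q′ μ)) (sym (coeff-++ p′ q′ μ)))

  ++-comm : (p q : Poly r n) → (p ++ q) ≈P (q ++ p)
  ++-comm p q μ = trans (coeff-++ p q μ) (trans (ℚP.+-comm (coeff p μ) (coeff q μ)) (sym (coeff-++ q p μ)))

  ++-isCommutativeMonoid : IsCommutativeMonoid (_≈P_ {r} {n}) _++_ []
  ++-isCommutativeMonoid = record
    { isMonoid = record
      { isSemigroup = record
        { isMagma = record { isEquivalence = ≈P-isEquivalence ; ∙-cong = λ {p} {p′} {q} {q′} → ++-cong p p′ q q′ }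
        ; assoc   = λ p q s → ≡⇒≈P (ListP.++-assoc p q s)
        }
      ; identity = (λ _ _ → refl) , (λ p → ≡⇒≈P (ListP.++-identityʳ p))
      }
    ; comm = ++-comm
    }

  ≈P-setoid : Setoid 0ℓ 0ℓ
  ≈P-setoid = record { isEquivalence = ≈P-isEquivalence }

  ++-commutativeMonoid : CommutativeMonoid 0ℓ 0ℓ
  ++-commutativeMonoid = record { isCommutativeMonoid = ++-isCommutativeMonoid }

  *P-zeroʳ : (p : Poly r n) → p *P [] ≡ []
  *P-zeroʳ []      = refl
  *P-zeroʳ (t ∷ p) = *P-zeroʳ p

  *P-distribʳ : (p q s : Poly r n) → (p ++ q) *P s ≡ p *P s ++ q *P s
  *P-distribʳ []      q s = refl
  *P-distribʳ (t ∷ p) q s =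
    trans (cong (termMul t s ++_) (*P-distribʳ p q s)) (sym (ListP.++-assoc (termMul t s) (p *P s) (q *P s)))

  ⊗-comm : (t u : Term) → t ⊗ u ≡ u ⊗ t
  ⊗-comm (a , μ) (b , ν) = cong₂ _,_ (ℚP.*-comm a b) (·M-comm μ ν)

  ⊗-assoc : (t u v : Term) → (t ⊗ u) ⊗ v ≡ t ⊗ (u ⊗ v)
  ⊗-assoc (a , μ) (b , ν) (c , ρ) = cong₂ _,_ (ℚP.*-assoc a b c) (·M-assoc μ ν ρ)

  termMul-⊗ : ∀ t u (s : Poly r n) → termMul (t ⊗ u) s ≡ termMul t (termMul u s)
  termMul-⊗ t u s = trans (ListP.map-cong (⊗-assoc t u) s) (ListP.map-∘ s)

  termMul-*P : ∀ t (q s : Poly r n) → termMul t q *P s ≡ termMul t (q *P s)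
  termMul-*P t []      s = refl
  termMul-*P t (u ∷ q) s = begin
    termMul (t ⊗ u) s ++ termMul t q *P s           ≡⟨ cong₂ _++_ (termMul-⊗ t u s) (termMul-*P t q s) ⟩
    termMul t (termMul u s) ++ termMul t (q *P s)   ≡⟨ sym (ListP.map-++ (t ⊗_) (termMul u s) (q *P s)) ⟩
    termMul t (termMul u s ++ q *P s)               ∎
    where open ≡-Reasoning

  *P-singletonʳ : ∀ t (q : Poly r n) → q *P (t ∷ []) ≡ termMul t q
  *P-singletonʳ t []      = refl
  *P-singletonʳ t (u ∷ q) = cong₂ _∷_ (⊗-comm u t) (*P-singletonʳ t q)

  *P-congʳ : (p q q′ : Poly r n) → q ≈P q′ → (p *P q) ≈P (p *P q′)
  *P-congʳ []      q q′ q≈q′ _ = refl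
  *P-congʳ (t ∷ p) q q′ q≈q′ =
    ++-cong (termMul t q) (termMul t q′) (p *P q) (p *P q′) (termMul-cong t q q′ q≈q′) (*P-congʳ p q q′ q≈q′)

  ++-congˡ : (p q q′ : Poly r n) → q ≈P q′ → (p ++ q) ≈P (p ++ q′)
  ++-congˡ p q q′ = ++-cong p p q q′ (λ _ → refl)

  module _ where
    open SetoidReasoning ≈P-setoid
    open CommutativeSemigroupProperties (CommutativeMonoid.commutativeSemigroup ++-commutativeMonoid)
      using (interchange)

    *P-distribˡ : (p q s : Poly r n) → (p *P (q ++ s)) ≈P (p *P q ++ p *P s)
    *P-distribˡ []      q s _ = refl
    *P-distribˡ (t ∷ p) q s = begin
      termMul t (q ++ s) ++ p *P (q ++ s)
        ≡⟨ cong (_++ p *P (q ++ s)) (ListP.map-++ (t ⊗_) q s) ⟩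
      (termMul t q ++ termMul t s) ++ p *P (q ++ s)
        ≈⟨ ++-congˡ (termMul t q ++ termMul t s) _ _ (*P-distribˡ p q s) ⟩
      (termMul t q ++ termMul t s) ++ (p *P q ++ p *P s)
        ≈⟨ interchange (termMul t q) (termMul t s) (p *P q) (p *P s) ⟩
      (termMul t q ++ p *P q) ++ (termMul t s ++ p *P s) ∎

    *P-comm : (p q : Poly r n) → (p *P q) ≈P (q *P p)
    *P-comm []      q = ≡⇒≈P (sym (*P-zeroʳ q))
    *P-comm (t ∷ p) q = begin
      termMul t q ++ p *P q         ≈⟨ ++-congˡ (termMul t q) _ _ (*P-comm p q) ⟩
      termMul t q ++ q *P p         ≡⟨ cong (_++ q *P p) (sym (*P-singletonʳ t q)) ⟩
      q *P (t ∷ []) ++ q *P p       ≈⟨ *P-distribˡ q (t ∷ []) p ⟨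
      q *P (t ∷ p)                  ∎

    *P-assoc : (p q s : Poly r n) → ((p *P q) *P s) ≈P (p *P (q *P s))
    *P-assoc []      q s _ = refl
    *P-assoc (t ∷ p) q s = begin
      (termMul t q ++ p *P q) *P s          ≡⟨ *P-distribʳ (termMul t q) (p *P q) s ⟩
      termMul t q *P s ++ (p *P q) *P s    ≡⟨ cong (_++ (p *P q) *P s) (termMul-*P t q s) ⟩
      termMul t (q *P s) ++ (p *P q) *P s  ≈⟨ ++-congˡ (termMul t (q *P s)) _ _ (*P-assoc p q s) ⟩
      termMul t (q *P s) ++ p *P (q *P s)  ∎

  oneP : Poly r n
  oneP = (1ℚ , oneM) ∷ []

  *P-identityˡ : (p : Poly r n) → oneP *P p ≡ p
  *P-identityˡ p = trans (ListP.++-identityʳ (termMul (1ℚ , oneM) p))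
    (trans (ListP.map-cong (λ { (a , μ) → cong₂ _,_ (ℚP.*-identityˡ a) (·M-identityˡ μ) }) p) (ListP.map-id p))

  *P-cong : (p p′ q q′ : Poly r n) → p ≈P p′ → q ≈P q′ → (p *P q) ≈P (p′ *P q′)
  *P-cong p p′ q q′ p≈p′ q≈q′ μ = begin
    coeff (p *P q) μ   ≡⟨ *P-congʳ p q q′ q≈q′ μ ⟩
    coeff (p *P q′) μ  ≡⟨ *P-comm p q′ μ ⟩
    coeff (q′ *P p) μ  ≡⟨ *P-congʳ q′ p p′ p≈p′ μ ⟩
    coeff (q′ *P p′) μ ≡⟨ *P-comm q′ p′ μ ⟩
    coeff (p′ *P q′) μ ∎
    where open ≡-Reasoning

Poly-commutativeSemiring : ℕ → ℕ → CommutativeSemiring 0ℓ 0ℓ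
Poly-commutativeSemiring r n = record
  { Carrier = Poly r n
  ; _≈_ = _≈P_
  ; _+_ = _++_
  ; _*_ = _*P_
  ; 0# = []
  ; 1# = oneP
  ; isCommutativeSemiring = IsCommutativeSemiringˡ.isCommutativeSemiring record
    { +-isCommutativeMonoid = ++-isCommutativeMonoid
    ; *-isCommutativeMonoid = record
      { isMonoid = record
        { isSemigroup = record
          { isMagma = record { isEquivalence = ≈P-isEquivalence ; ∙-cong = λ {p} {p′} {q} {q′} → *P-cong p p′ q q′ }
          ; assoc = *P-assoc
          }
        ; identity = (λ p → ≡⇒≈P (*P-identityˡ p)) , (λ p μ → trans (*P-comm p oneP μ) (≡⇒≈P (*P-identityˡ p) μ))
        }
      ; comm = *P-comm
      }
    ; distribʳ = λ s p q → ≡⇒≈P (*P-distribʳ p q s)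
    ; zeroˡ = λ _ _ → refl
    }
  }

module _ {c ℓ} (M : CommutativeMonoid c ℓ) where
  open CommutativeMonoid M renaming (ε to 0#)
  open import Algebra.Properties.CommutativeMonoid.Sum M using (sum; sum-remove; sum-cong-≋; sum-replicate-zero)
  open SetoidReasoning setoid

  sum-supported-at : ∀ {k} (f : Vector Carrier k) i → (∀ j → j ≢ i → f j ≈ 0#) → sum f ≈ f i
  sum-supported-at {ℕ.suc k} f i f≈0 = begin
    sum f                        ≈⟨ sum-remove {i = i} f ⟩
    f i ∙ sum (removeAt f i)     ≈⟨ ∙-congˡ (sum-cong-≋ {k} (λ j → f≈0 (Fin.punchIn i j) (FinP.punchInᵢ≢i i j))) ⟩
    f i ∙ sum {k} (λ _ → 0#)     ≈⟨ ∙-congˡ (sum-replicate-zero k) ⟩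
    f i ∙ 0#                     ≈⟨ identityʳ (f i) ⟩
    f i                          ∎

module _ {c ℓ} (R : CommutativeSemiring c ℓ) where
  open CommutativeSemiring R hiding (sym) renaming (refl to ≈-refl; trans to ≈-trans)
  open import Algebra.Properties.Semiring.Sum semiring
  open import Algebra.Solver.Ring.NaturalCoefficients.Default R
  open SetoidReasoning setoid

  ∑-*-∑-comm : ∀ {k l} (a : Vector Carrier k) (V : Fin l → Fin k → Carrier) (δ : Vector Carrier l) →
    sum (λ t → a t * sum (λ j → V j t * δ j)) ≈ sum (λ j → sum (λ t → a t * V j t) * δ j)
  ∑-*-∑-comm a V δ = begin
    sum (λ t → a t * sum (λ j → V j t * δ j))    ≈⟨ sum-cong-≋ (λ t → *-distribˡ-sum (a t) (λ j → V j t * δ j)) ⟩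
    sum (λ t → sum (λ j → a t * (V j t * δ j)))  ≈⟨ ∑-comm (λ t j → a t * (V j t * δ j)) ⟩
    sum (λ j → sum (λ t → a t * (V j t * δ j)))  ≈⟨ sum-cong-≋ (λ j → sum-cong-≋ (λ t → *-assoc (a t) (V j t) (δ j))) ⟨
    sum (λ j → sum (λ t → a t * V j t * δ j))    ≈⟨ sum-cong-≋ (λ j → *-distribʳ-sum (δ j) (λ t → a t * V j t)) ⟨
    sum (λ j → sum (λ t → a t * V j t) * δ j)    ∎

  shifted-combination : ∀ {k} (G G′ a b h : Vector Carrier k) (z C L d p : Carrier) →
    (∀ s → G′ s ≈ G s + b s * z) →
    C * z ≈ L * sum (λ t → a t * G t) →
    d * p ≈ sum (λ s → h s * G′ s) →
    (C * d) * p ≈ sum (λ t → (C * h t + a t * (L * sum (λ s → b s * h s))) * G t)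
  shifted-combination G G′ a b h z C L d p G′≈ Cz≈ dp≈ = begin
    (C * d) * p                                            ≈⟨ *-assoc C d p ⟩
    C * (d * p)                                            ≈⟨ *-congˡ dp≈ ⟩
    C * sum (λ s → h s * G′ s)                             ≈⟨ *-distribˡ-sum C (λ s → h s * G′ s) ⟩
    sum (λ s → C * (h s * G′ s))                           ≈⟨ sum-cong-≋ expand ⟩
    sum (λ s → C * h s * G s + b s * h s * (C * z))
      ≈⟨ ∑-distrib-+ (λ s → C * h s * G s) (λ s → b s * h s * (C * z)) ⟩
    sum (λ s → C * h s * G s) + sum (λ s → b s * h s * (C * z))
      ≈⟨ +-congˡ shift ⟩
    sum (λ t → C * h t * G t) + sum (λ t → a t * (L * S) * G t)
      ≈⟨ ∑-distrib-+ (λ t → C * h t * G t) (λ t → a t * (L * S) * G t) ⟨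
    sum (λ t → C * h t * G t + a t * (L * S) * G t)        ≈⟨ sum-cong-≋ (λ t → distribʳ (G t) _ _) ⟨
    sum (λ t → (C * h t + a t * (L * S)) * G t)            ∎
    where
    S : Carrier
    S = sum (λ s → b s * h s)

    expand : ∀ s → C * (h s * G′ s) ≈ C * h s * G s + b s * h s * (C * z)
    expand s = ≈-trans (*-congˡ (*-congˡ (G′≈ s)))
      (solve 5 (λ C h G b z → C :* (h :* (G :+ b :* z)) := C :* h :* G :+ b :* h :* (C :* z)) ≈-refl C (h s) (G s) (b s) z)

    shift : sum (λ s → b s * h s * (C * z)) ≈ sum (λ t → a t * (L * S) * G t)
    shift = begin
      sum (λ s → b s * h s * (C * z))        ≈⟨ *-distribʳ-sum (C * z) (λ s → b s * h s) ⟨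
      S * (C * z)                            ≈⟨ *-congˡ Cz≈ ⟩
      S * (L * sum (λ t → a t * G t))        ≈⟨ *-assoc S L _ ⟨
      S * L * sum (λ t → a t * G t)          ≈⟨ *-distribˡ-sum (S * L) (λ t → a t * G t) ⟩
      sum (λ t → S * L * (a t * G t))
        ≈⟨ sum-cong-≋ (λ t → solve 4 (λ S L a G → S :* L :* (a :* G) := a :* (L :* S) :* G) ≈-refl S L (a t) (G t)) ⟩
      sum (λ t → a t * (L * S) * G t)        ∎

ℚ-commutativeSemiring : CommutativeSemiring 0ℓ 0ℓ
ℚ-commutativeSemiring = CommutativeRing.commutativeSemiring ℚP.+-*-commutativeRing

module ℚΣ = Algebra.Properties.Semiring.Sum (CommutativeSemiring.semiring ℚ-commutativeSemiring)
module ℚRing = Algebra.Properties.Ring (CommutativeRing.ring ℚP.+-*-commutativeRing)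

p≢0⇒p*q≡0⇒q≡0 : ∀ p q → p ≢ 0ℚ → p ℚ.* q ≡ 0ℚ → q ≡ 0ℚ
p≢0⇒p*q≡0⇒q≡0 p q p≢0 pq≡0 = begin
  q                    ≡⟨ ℚP.*-identityˡ q ⟨
  1ℚ ℚ.* q             ≡⟨ cong (ℚ._* q) (ℚP.*-inverseˡ p) ⟨
  (ℚ.1/ p ℚ.* p) ℚ.* q ≡⟨ ℚP.*-assoc (ℚ.1/ p) p q ⟩
  ℚ.1/ p ℚ.* (p ℚ.* q) ≡⟨ cong (ℚ.1/ p ℚ.*_) pq≡0 ⟩
  ℚ.1/ p ℚ.* 0ℚ        ≡⟨ ℚP.*-zeroʳ (ℚ.1/ p) ⟩
  0ℚ                   ∎
  where
  open ≡-Reasoning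
  instance _ = ℚ.≢-nonZero p≢0

ℕtoℚ≡mkℚ : ∀ a → ℕtoℚ a ≡ mkℚ (ℤ.+ a) 0 (Coprime.sym (1-coprimeTo a))
ℕtoℚ≡mkℚ a = ℚP.normalize-coprime (Coprime.sym (1-coprimeTo a))

ℕtoℚ-+ : ∀ a b → ℕtoℚ (a ℕ.+ b) ≡ ℕtoℚ a ℚ.+ ℕtoℚ b
ℕtoℚ-+ a b rewrite ℕtoℚ≡mkℚ a | ℕtoℚ≡mkℚ b | ℕP.*-identityʳ a | ℕP.*-identityʳ b
                 | ℤP.+◃n≡+n a | ℤP.+◃n≡+n b = refl

ℕtoℚ-* : ∀ a b → ℕtoℚ (a ℕ.* b) ≡ ℕtoℚ a ℚ.* ℕtoℚ b
ℕtoℚ-* a b rewrite ℕtoℚ≡mkℚ a | ℕtoℚ≡mkℚ b | ℤP.+◃n≡+n (a ℕ.* b) = refl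

ℕtoℚ-suc≢0 : ∀ a → ℕtoℚ (ℕ.suc a) ≢ 0ℚ
ℕtoℚ-suc≢0 a eq with trans (sym (ℕtoℚ≡mkℚ (ℕ.suc a))) eq
... | ()

ℕtoℚ-∑ : ∀ k (f : Fin k → ℕ) → ℕtoℚ (∑ k f) ≡ ℚΣ.sum (λ j → ℕtoℚ (f j))
ℕtoℚ-∑ ℕ.zero    f = refl
ℕtoℚ-∑ (ℕ.suc k) f = trans (ℕtoℚ-+ (f Fin.zero) _) (cong (ℕtoℚ (f Fin.zero) ℚ.+_) (ℕtoℚ-∑ k (f ∘ Fin.suc)))

∑-zero : ∀ k (f : Fin k → ℕ) → (∀ j → f j ≡ 0) → ∑ k f ≡ 0
∑-zero ℕ.zero    f f≡0 = refl
∑-zero (ℕ.suc k) f f≡0 = cong₂ ℕ._+_ (f≡0 Fin.zero) (∑-zero k (f ∘ Fin.suc) (f≡0 ∘ Fin.suc))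

indicator-nz : ∀ x → x ≤ 1 → (if nz x then 1 else 0) ≡ x
indicator-nz 0 _ = refl
indicator-nz 1 _ = refl
indicator-nz (ℕ.suc (ℕ.suc x)) (ℕ.s≤s ())

∑-sub : ∀ {k} (f g : Fin k → ℚ) → ℚΣ.sum (λ j → f j ℚ.- g j) ≡ ℚΣ.sum f ℚ.- ℚΣ.sum g
∑-sub {ℕ.zero}  f g = refl
∑-sub {ℕ.suc k} f g = begin
  (f₀ ℚ.- g₀) ℚ.+ ℚΣ.sum (λ j → f (Fin.suc j) ℚ.- g (Fin.suc j))
    ≡⟨ cong ((f₀ ℚ.- g₀) ℚ.+_) (∑-sub (f ∘ Fin.suc) (g ∘ Fin.suc)) ⟩
  (f₀ ℚ.- g₀) ℚ.+ (Σf ℚ.- Σg)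
    ≡⟨ solve 4 (λ f₀ g₀ Σf Σg → (f₀ :- g₀) :+ (Σf :- Σg) := (f₀ :+ Σf) :- (g₀ :+ Σg)) refl f₀ g₀ Σf Σg ⟩
  (f₀ ℚ.+ Σf) ℚ.- (g₀ ℚ.+ Σg)
    ∎
  where
  open ≡-Reasoning
  open +-*-Solver
  f₀ = f Fin.zero
  g₀ = g Fin.zero
  Σf = ℚΣ.sum (f ∘ Fin.suc)
  Σg = ℚΣ.sum (g ∘ Fin.suc)

balance-difference : ∀ A B A′ B′ R R′ κ →
  A ℚ.+ R ≡ (B ℚ.+ R′) ℚ.+ κ → A′ ℚ.+ R ≡ B′ ℚ.+ R′ → (A ℚ.- B) ℚ.- (A′ ℚ.- B′) ≡ κ
balance-difference A B A′ B′ R R′ κ eq eq′ = begin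
  (A ℚ.- B) ℚ.- (A′ ℚ.- B′)
    ≡⟨ solve 6 (λ A B A′ B′ R R′ → (A :- B) :- (A′ :- B′) := ((A :+ R) :- (B :+ R′)) :- ((A′ :+ R) :- (B′ :+ R′)))
               refl A B A′ B′ R R′ ⟩
  ((A ℚ.+ R) ℚ.- (B ℚ.+ R′)) ℚ.- ((A′ ℚ.+ R) ℚ.- (B′ ℚ.+ R′))
    ≡⟨ cong₂ (λ x y → (x ℚ.- (B ℚ.+ R′)) ℚ.- (y ℚ.- (B′ ℚ.+ R′))) eq eq′ ⟩
  (((B ℚ.+ R′) ℚ.+ κ) ℚ.- (B ℚ.+ R′)) ℚ.- ((B′ ℚ.+ R′) ℚ.- (B′ ℚ.+ R′))
    ≡⟨ solve 4 (λ B R′ κ B′ → (((B :+ R′) :+ κ) :- (B :+ R′)) :- ((B′ :+ R′) :- (B′ :+ R′)) := κ) refl B R′ κ B′ ⟩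
  κ ∎
  where
  open ≡-Reasoning
  open +-*-Solver

module _ {r n : ℕ} where
  private
    module PΣ = Algebra.Properties.Semiring.Sum (CommutativeSemiring.semiring (Poly-commutativeSemiring r n))

  concat-map-tabulate : ∀ {A : Set} {k} (f : A → Poly r n) (g : Fin k → A) →
    concat (List.map f (List.tabulate g)) ≡ PΣ.sum (f ∘ g)
  concat-map-tabulate {k = ℕ.zero}  f g = refl
  concat-map-tabulate {k = ℕ.suc k} f g = cong (f (g Fin.zero) ++_) (concat-map-tabulate f (g ∘ Fin.suc))

  ΣP≡sum : ∀ {k} (f : Fin k → Poly r n) → ΣP f ≡ PΣ.sum f
  ΣP≡sum f = concat-map-tabulate f (λ j → j)

  coeff-sum : ∀ {k} (f : Fin k → Poly r n) μ → coeff (PΣ.sum f) μ ≡ ℚΣ.sum (λ j → coeff (f j) μ)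
  coeff-sum {ℕ.zero}  f μ = refl
  coeff-sum {ℕ.suc k} f μ =
    trans (coeff-++ (f Fin.zero) _ μ) (cong (coeff (f Fin.zero) μ ℚ.+_) (coeff-sum (f ∘ Fin.suc) μ))

  coeff-ΣP : ∀ {k} (f : Fin k → Poly r n) μ → coeff (ΣP f) μ ≡ ℚΣ.sum (λ j → coeff (f j) μ)
  coeff-ΣP f μ = trans (cong (λ q → coeff q μ) (ΣP≡sum f)) (coeff-sum f μ)

  coeff-singleton : ∀ t (μ : Mono r n) → coeff (t ∷ []) μ ≡ termCoeff t μ
  coeff-singleton t μ = ℚP.+-identityʳ (termCoeff t μ)

  termCoeff-scale : ∀ c (μ ρ : Mono r n) → termCoeff (c , μ) ρ ≡ c ℚ.* termCoeff (1ℚ , μ) ρ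
  termCoeff-scale c μ ρ with does (μ ≟M ρ)
  ... | true  = sym (ℚP.*-identityʳ c)
  ... | false = sym (ℚP.*-zeroʳ c)

  *P-singletonˡ : ∀ t (q : Poly r n) → (t ∷ []) *P q ≡ termMul t q
  *P-singletonˡ t q = ListP.++-identityʳ (termMul t q)

  const : ℚ → Poly r n
  const c = (c , oneM) ∷ []

  coeff-const-*P : ∀ c (p : Poly r n) μ → coeff (const c *P p) μ ≡ c ℚ.* coeff p μ
  coeff-const-*P c p μ = begin
    coeff (const c *P p) μ                    ≡⟨ cong (λ q → coeff q μ) (*P-singletonˡ (c , oneM) p) ⟩
    coeff (termMul (c , oneM) p) μ            ≡⟨ cong (coeff (termMul (c , oneM) p)) (·M-identityˡ μ) ⟨
    coeff (termMul (c , oneM) p) (oneM ·M μ)  ≡⟨ coeff-termMul-· c oneM μ p ⟩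
    c ℚ.* coeff p μ                           ∎
    where open ≡-Reasoning

  lincomb : (Fin n → ℚ) → (Fin n → Poly r n) → Poly r n
  lincomb a G = ΣP (λ t → const (a t) *P G t)

  coeff-lincomb : ∀ (a : Fin n → ℚ) G μ → coeff (lincomb a G) μ ≡ ℚΣ.sum (λ t → a t ℚ.* coeff (G t) μ)
  coeff-lincomb a G μ =
    trans (coeff-ΣP (λ t → const (a t) *P G t) μ) (ℚΣ.sum-cong-≗ {n} (λ t → coeff-const-*P (a t) (G t) μ))

  lincomb-shift : (a b : Fin n → ℚ) (G G′ : Fin n → Poly r n) (z : Poly r n) →
    (∀ s → G′ s ≈P (G s ++ const (b s) *P z)) → ℚΣ.sum (λ s → a s ℚ.* b s) ≡ 0ℚ →
    lincomb a G′ ≈P lincomb a G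
  lincomb-shift a b G G′ z G′≈ ab≡0 μ = begin
    coeff (lincomb a G′) μ                   ≡⟨ coeff-lincomb a G′ μ ⟩
    ℚΣ.sum (λ t → a t ℚ.* coeff (G′ t) μ)    ≡⟨ ℚΣ.sum-cong-≗ {n} shifted ⟩
    ℚΣ.sum (λ t → A t ℚ.+ a t ℚ.* b t ℚ.* c) ≡⟨ ℚΣ.∑-distrib-+ A (λ t → a t ℚ.* b t ℚ.* c) ⟩
    ΣA ℚ.+ ℚΣ.sum (λ t → a t ℚ.* b t ℚ.* c)  ≡⟨ cong (ΣA ℚ.+_) (ℚΣ.*-distribʳ-sum c (λ t → a t ℚ.* b t)) ⟨
    ΣA ℚ.+ ℚΣ.sum (λ t → a t ℚ.* b t) ℚ.* c  ≡⟨ cong (λ x → ΣA ℚ.+ x ℚ.* c) ab≡0 ⟩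
    ΣA ℚ.+ 0ℚ ℚ.* c                          ≡⟨ solve 2 (λ ΣA c → ΣA :+ con 0ℚ :* c := ΣA) refl ΣA c ⟩
    ΣA                                       ≡⟨ coeff-lincomb a G μ ⟨
    coeff (lincomb a G) μ                    ∎
    where
    open ≡-Reasoning
    open +-*-Solver
    c : ℚ
    c = coeff z μ
    A : Fin n → ℚ
    A t = a t ℚ.* coeff (G t) μ
    ΣA : ℚ
    ΣA = ℚΣ.sum A
    shifted : ∀ t → a t ℚ.* coeff (G′ t) μ ≡ A t ℚ.+ a t ℚ.* b t ℚ.* c
    shifted t = begin
      a t ℚ.* coeff (G′ t) μ                          ≡⟨ cong (a t ℚ.*_) (G′≈ t μ) ⟩
      a t ℚ.* coeff (G t ++ const (b t) *P z) μ       ≡⟨ cong (a t ℚ.*_) (coeff-++ (G t) (const (b t) *P z) μ) ⟩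
      a t ℚ.* (coeff (G t) μ ℚ.+ coeff (const (b t) *P z) μ)
        ≡⟨ cong (λ x → a t ℚ.* (coeff (G t) μ ℚ.+ x)) (coeff-const-*P (b t) z μ) ⟩
      a t ℚ.* (coeff (G t) μ ℚ.+ b t ℚ.* c)
        ≡⟨ solve 4 (λ a g b c → a :* (g :+ b :* c) := a :* g :+ a :* b :* c) refl (a t) (coeff (G t) μ) (b t) c ⟩
      A t ℚ.+ a t ℚ.* b t ℚ.* c                       ∎

  PreservesDenominators : Poly r n → Set
  PreservesDenominators C = ∀ d → KappaOnly d → NonZeroP d → KappaOnly (C *P d) × NonZeroP (C *P d)

  κ-term-preservesDenominators : ∀ a μ → a ≢ 0ℚ → xexp μ ≡ zeroC → PreservesDenominators ((a , μ) ∷ [])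
  κ-term-preservesDenominators a μ a≢0 μ∈ℚ[κ] d κd d≢0 = κ[Cd] , Cd≢0
    where
    coeff-Cd : ∀ ρ → coeff (((a , μ) ∷ []) *P d) ρ ≡ coeff (termMul (a , μ) d) ρ
    coeff-Cd ρ = cong (λ q → coeff q ρ) (*P-singletonˡ (a , μ) d)

    κ[Cd] : KappaOnly (((a , μ) ∷ []) *P d)
    κ[Cd] ρ ρ∉ℚ[κ] with μ ∣M? ρ
    ... | no ∤ = trans (coeff-Cd ρ) (coeff-termMul-∤ a μ ρ d ∤)
    ... | yes (ν , refl) = begin
      coeff (((a , μ) ∷ []) *P d) (μ ·M ν) ≡⟨ trans (coeff-Cd (μ ·M ν)) (coeff-termMul-· a μ ν d) ⟩
      a ℚ.* coeff d ν                      ≡⟨ cong (a ℚ.*_) (κd ν ν∉ℚ[κ]) ⟩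
      a ℚ.* 0ℚ                             ≡⟨ ℚP.*-zeroʳ a ⟩
      0ℚ                                   ∎
      where
      open ≡-Reasoning
      ν∉ℚ[κ] : xexp ν ≢ zeroC
      ν∉ℚ[κ] ν∈ℚ[κ] = ρ∉ℚ[κ]
        (trans (cong₂ (zipWith ℕ._+_) μ∈ℚ[κ] ν∈ℚ[κ]) (VecP.zipWith-identityˡ ℕP.+-identityˡ zeroC))

    Cd≢0 : NonZeroP (((a , μ) ∷ []) *P d)
    Cd≢0 Cd≡0 = d≢0 λ ν → p≢0⇒p*q≡0⇒q≡0 a (coeff d ν) a≢0
      (trans (sym (coeff-termMul-· a μ ν d)) (trans (sym (coeff-Cd (μ ·M ν))) (Cd≡0 (μ ·M ν))))

  InIdeal-shift : (G G′ a b : Fin n → Poly r n) (z C L : Poly r n) → PreservesDenominators C →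
    (∀ s → G′ s ≈P (G s ++ b s *P z)) →
    (C *P z) ≈P (L *P ΣP (λ t → a t *P G t)) →
    ∀ p → InIdeal G′ p → InIdeal G p
  InIdeal-shift G G′ a b z C L C-ok G′≈ Cz≈ p (d , κd , d≢0 , h , dp≈) =
    C *P d , proj₁ (C-ok d κd d≢0) , proj₂ (C-ok d κd d≢0) , h′ , λ μ →
      trans (shifted-combination (Poly-commutativeSemiring r n) G G′ a b h z C L d p G′≈
               (λ ν → trans (Cz≈ ν) (cong (λ q → coeff (L *P q) ν) (ΣP≡sum (λ t → a t *P G t))))
               (λ ν → trans (dp≈ ν) (cong (λ q → coeff q ν) (ΣP≡sum (λ s → h s *P G′ s)))) μ)
            (cong (λ q → coeff q μ) (sym (ΣP≡sum (λ t → h′ t *P G t))))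
    where
    h′ : Fin n → Poly r n
    h′ t = C *P h t ++ a t *P (L *P PΣ.sum (λ s → b s *P h s))

-- Degrees in the network hypergraph

-- deg N E (inj₁ j) and deg N E (inj₂ j) unfold to  speciesDeg E y_j + reactionDeg E j  and
-- speciesDeg E y_j' + reactionDeg E j: u_j and v_j lie in the same reaction edges.
module Degrees {n m : ℕ} (N : Network n m) where

  speciesDeg : Multiset n m → Complex n → ℕ
  speciesDeg E y = ∑ n (λ s → E (inj₁ s) ℕ.* (if nz (lookup y s) then 1 else 0))

  reactionDeg : Multiset n m → Fin m → ℕ
  reactionDeg E j = ∑ m (λ l → E (inj₂ l) ℕ.* (if memb N (inj₂ l) (inj₂ j) then 1 else 0))

  pairing : Multiset n m → Complex n → ℚ
  pairing E y = ℚΣ.sum (λ s → ℕtoℚ (E (inj₁ s)) ℚ.* ℕtoℚ (lookup y s))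

  ℕtoℚ-speciesDeg : ∀ E (y : Complex n) → (∀ s → lookup y s ≤ 1) → ℕtoℚ (speciesDeg E y) ≡ pairing E y
  ℕtoℚ-speciesDeg E y y≤1 = trans (ℕtoℚ-∑ n _) (ℚΣ.sum-cong-≗ {n} λ s →
    trans (ℕtoℚ-* (E (inj₁ s)) _) (cong (λ x → ℕtoℚ (E (inj₁ s)) ℚ.* ℕtoℚ x) (indicator-nz _ (y≤1 s))))

  reactionDeg-vanishes : ∀ E j → E (inj₂ j) ≡ 0 → reactionDeg E j ≡ 0
  reactionDeg-vanishes E j Eⱼ≡0 = ∑-zero m _ term≡0
    where
    term≡0 : ∀ l → E (inj₂ l) ℕ.* (if memb N (inj₂ l) (inj₂ j) then 1 else 0) ≡ 0
    term≡0 l with l FinP.≟ j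
    ... | yes refl = cong (ℕ._* _) Eⱼ≡0
    ... | no _     = trans (cong (λ b → E (inj₂ l) ℕ.* (if b then 1 else 0)) (BoolP.∧-zeroʳ (isNonZeroC (product N l))))
                           (ℕP.*-zeroʳ (E (inj₂ l)))

  stoich : Fin m → Fin n → ℚ
  stoich j s = ℕtoℚ (lookup (product N j) s) ℚ.- ℕtoℚ (lookup (reactant N j) s)

  coeff-xdot : ∀ {r} (ρ : Fin m → Fin r) s μ →
    coeff (xdot N ρ s) μ ≡ ℚΣ.sum (λ j → stoich j s ℚ.* termCoeff (1ℚ , mono (unitV (ρ j)) (reactant N j)) μ)
  coeff-xdot ρ s μ = trans (coeff-ΣP (λ j → (stoich j s , μⱼ j) ∷ []) μ)
    (ℚΣ.sum-cong-≗ {m} λ j → trans (coeff-singleton (stoich j s , μⱼ j) μ) (termCoeff-scale (stoich j s) (μⱼ j) μ))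
    where
    μⱼ : Fin m → Mono _ n
    μⱼ j = mono (unitV (ρ j)) (reactant N j)

module Balance {n m} (N : Network n m) (N01 : Is01 N) (i : Fin m) (Er Eb : Multiset n m)
  (bal : AlmostBalanced N Er Eb (inj₂ i)) (Eᵢ∉E : EdgeNotIn N Er Eb i) where

  open Degrees N

  weight : Fin n → ℚ
  weight s = ℕtoℚ (Er (inj₁ s)) ℚ.- ℕtoℚ (Eb (inj₁ s))

  excess : ℚ
  excess = ℕtoℚ (proj₁ (proj₁ bal))

  excess≢0 : excess ≢ 0ℚ
  excess≢0 with proj₁ bal
  ... | ℕ.suc k , _ , _ = ℕtoℚ-suc≢0 k

  weight-pairing : ∀ y → ℚΣ.sum (λ s → weight s ℚ.* ℕtoℚ (lookup y s)) ≡ pairing Er y ℚ.- pairing Eb y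
  weight-pairing y = trans (ℚΣ.sum-cong-≗ {n} λ s → ℚRing.[y-z]x≈yx-zx (yₛ s) (rₛ s) (bₛ s))
    (∑-sub (λ s → rₛ s ℚ.* yₛ s) (λ s → bₛ s ℚ.* yₛ s))
    where
    rₛ bₛ yₛ : Fin n → ℚ
    rₛ s = ℕtoℚ (Er (inj₁ s))
    bₛ s = ℕtoℚ (Eb (inj₁ s))
    yₛ s = ℕtoℚ (lookup y s)

  weight-stoich : ∀ j → ℚΣ.sum (λ s → weight s ℚ.* stoich j s) ≡
    (pairing Er (product N j) ℚ.- pairing Eb (product N j)) ℚ.- (pairing Er (reactant N j) ℚ.- pairing Eb (reactant N j))
  weight-stoich j = trans (ℚΣ.sum-cong-≗ {n} λ s → ℚRing.x[y-z]≈xy-xz (weight s) (y′ s) (y s))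
    (trans (∑-sub (λ s → weight s ℚ.* y′ s) (λ s → weight s ℚ.* y s))
           (cong₂ ℚ._-_ (weight-pairing (product N j)) (weight-pairing (reactant N j))))
    where
    y′ y : Fin n → ℚ
    y′ s = ℕtoℚ (lookup (product N j) s)
    y  s = ℕtoℚ (lookup (reactant N j) s)

  deg-product : ∀ E j → ℕtoℚ (deg N E (inj₂ j)) ≡ pairing E (product N j) ℚ.+ ℕtoℚ (reactionDeg E j)
  deg-product E j = trans (ℕtoℚ-+ (speciesDeg E (product N j)) (reactionDeg E j))
    (cong (ℚ._+ ℕtoℚ (reactionDeg E j)) (ℕtoℚ-speciesDeg E (product N j) (λ s → proj₂ (N01 j s))))

  deg-reactant : ∀ E j → ℕtoℚ (deg N E (inj₁ j)) ≡ pairing E (reactant N j) ℚ.+ ℕtoℚ (reactionDeg E j)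
  deg-reactant E j = trans (ℕtoℚ-+ (speciesDeg E (reactant N j)) (reactionDeg E j))
    (cong (ℚ._+ ℕtoℚ (reactionDeg E j)) (ℕtoℚ-speciesDeg E (reactant N j) (λ s → proj₁ (N01 j s))))

  balanced : ∀ w → w ≢ inj₂ i → ℕtoℚ (deg N Er w) ≡ ℕtoℚ (deg N Eb w)
  balanced w w≢vᵢ = cong ℕtoℚ (proj₂ bal w w≢vᵢ)

  reactant-balanced : ∀ j → pairing Er (reactant N j) ℚ.+ ℕtoℚ (reactionDeg Er j) ≡
                            pairing Eb (reactant N j) ℚ.+ ℕtoℚ (reactionDeg Eb j)
  reactant-balanced j = trans (sym (deg-reactant Er j)) (trans (balanced (inj₁ j) λ ()) (deg-reactant Eb j))

  weight-stoich-from-product : ∀ j κ →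
    pairing Er (product N j) ℚ.+ ℕtoℚ (reactionDeg Er j) ≡ (pairing Eb (product N j) ℚ.+ ℕtoℚ (reactionDeg Eb j)) ℚ.+ κ →
    ℚΣ.sum (λ s → weight s ℚ.* stoich j s) ≡ κ
  weight-stoich-from-product j κ eq = trans (weight-stoich j)
    (balance-difference (pairing Er (product N j)) (pairing Eb (product N j))
                        (pairing Er (reactant N j)) (pairing Eb (reactant N j))
                        (ℕtoℚ (reactionDeg Er j)) (ℕtoℚ (reactionDeg Eb j)) κ eq (reactant-balanced j))

  weight-stoich-off : ∀ j → j ≢ i → ℚΣ.sum (λ s → weight s ℚ.* stoich j s) ≡ 0ℚ
  weight-stoich-off j j≢i = weight-stoich-from-product j 0ℚ (begin
    pairing Er (product N j) ℚ.+ ℕtoℚ (reactionDeg Er j)             ≡⟨ deg-product Er j ⟨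
    ℕtoℚ (deg N Er (inj₂ j))                                         ≡⟨ balanced (inj₂ j) vⱼ≢vᵢ ⟩
    ℕtoℚ (deg N Eb (inj₂ j))                                         ≡⟨ deg-product Eb j ⟩
    pairing Eb (product N j) ℚ.+ ℕtoℚ (reactionDeg Eb j)             ≡⟨ ℚP.+-identityʳ _ ⟨
    (pairing Eb (product N j) ℚ.+ ℕtoℚ (reactionDeg Eb j)) ℚ.+ 0ℚ   ∎)
    where
    open ≡-Reasoning
    vⱼ≢vᵢ : inj₂ j ≢ inj₂ i
    vⱼ≢vᵢ refl = j≢i refl

  weight-stoich-at : ℚΣ.sum (λ s → weight s ℚ.* stoich i s) ≡ excess
  weight-stoich-at = weight-stoich-from-product i excess (begin
    pairing Er (product N i) ℚ.+ ℕtoℚ (reactionDeg Er i)                ≡⟨ deg-product Er i ⟨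
    ℕtoℚ (deg N Er (inj₂ i))                                            ≡⟨ cong ℕtoℚ (proj₂ (proj₂ (proj₁ bal))) ⟩
    ℕtoℚ (deg N Eb (inj₂ i) ℕ.+ proj₁ (proj₁ bal))                      ≡⟨ ℕtoℚ-+ (deg N Eb (inj₂ i)) _ ⟩
    ℕtoℚ (deg N Eb (inj₂ i)) ℚ.+ excess                                 ≡⟨ cong (ℚ._+ excess) (deg-product Eb i) ⟩
    (pairing Eb (product N i) ℚ.+ ℕtoℚ (reactionDeg Eb i)) ℚ.+ excess   ∎)
    where open ≡-Reasoning

  -- The only use of E_i ∉ E: the sole reaction edge through u_i carries no weight.
  weight-reactant : ℚΣ.sum (λ s → weight s ℚ.* ℕtoℚ (lookup (reactant N i) s)) ≡ 0ℚ
  weight-reactant = begin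
    ℚΣ.sum (λ s → weight s ℚ.* ℕtoℚ (lookup yᵢ s))   ≡⟨ weight-pairing yᵢ ⟩
    pairing Er yᵢ ℚ.- pairing Eb yᵢ                   ≡⟨ cong (ℚ._- pairing Eb yᵢ) pairings-agree ⟩
    pairing Eb yᵢ ℚ.- pairing Eb yᵢ                   ≡⟨ ℚP.+-inverseʳ (pairing Eb yᵢ) ⟩
    0ℚ                                                ∎
    where
    open ≡-Reasoning
    yᵢ : Complex n
    yᵢ = reactant N i

    Eᵢ-absent : Er (inj₂ i) ℕ.+ Eb (inj₂ i) ≡ 0
    Eᵢ-absent = Eᵢ∉E (inj₂ i) (λ _ → refl)

    pairings-agree : pairing Er yᵢ ≡ pairing Eb yᵢ
    pairings-agree = begin
      pairing Er yᵢ                                   ≡⟨ ℚP.+-identityʳ _ ⟨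
      pairing Er yᵢ ℚ.+ ℕtoℚ 0
        ≡⟨ cong (λ x → pairing Er yᵢ ℚ.+ ℕtoℚ x) (reactionDeg-vanishes Er i (ℕP.m+n≡0⇒m≡0 _ Eᵢ-absent)) ⟨
      pairing Er yᵢ ℚ.+ ℕtoℚ (reactionDeg Er i)       ≡⟨ reactant-balanced i ⟩
      pairing Eb yᵢ ℚ.+ ℕtoℚ (reactionDeg Eb i)
        ≡⟨ cong (λ x → pairing Eb yᵢ ℚ.+ ℕtoℚ x) (reactionDeg-vanishes Eb i (ℕP.m+n≡0⇒n≡0 (Er (inj₂ i)) Eᵢ-absent)) ⟩
      pairing Eb yᵢ ℚ.+ ℕtoℚ 0                        ≡⟨ ℚP.+-identityʳ _ ⟩
      pairing Eb yᵢ                                   ∎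

  y : Fin n → ℚ
  y s = ℕtoℚ (lookup (reactant N i) s)

  -- κ-variable 0 is κ_i'. With k the excess: z = κ_i' x^{y_i}, L = κ_i', C = k κ_i, K = k κ_i x^{y_i}.
  z L C K : Poly (ℕ.suc m) n
  z = (1ℚ , mono (unitV Fin.zero) (reactant N i)) ∷ []
  L = (1ℚ , mono (unitV Fin.zero) zeroC) ∷ []
  C = (excess , mono (unitV (Fin.suc i)) zeroC) ∷ []
  K = (excess , mono (unitV (Fin.suc i)) (reactant N i)) ∷ []

  C-preservesDenominators : PreservesDenominators C
  C-preservesDenominators = κ-term-preservesDenominators excess (mono (unitV (Fin.suc i)) zeroC) excess≢0 refl

  Cz≈LK : (C *P z) ≈P (L *P K)
  Cz≈LK = ≡⇒≈P (cong (λ t → t ∷ [])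
    (cong₂ _,_ (ℚP.*-comm excess 1ℚ) (cong₂ mono (VecP.zipWith-comm ℕP.+-comm (unitV (Fin.suc i)) (unitV Fin.zero)) refl)))

  lincomb-ssN : lincomb weight (ssN N) ≈P K
  lincomb-ssN μ = begin
    coeff (lincomb weight (ssN N)) μ                                 ≡⟨ coeff-lincomb weight (ssN N) μ ⟩
    ℚΣ.sum (λ t → weight t ℚ.* coeff (ssN N t) μ)
      ≡⟨ ℚΣ.sum-cong-≗ {n} (λ t → cong (weight t ℚ.*_) (coeff-xdot Fin.suc t μ)) ⟩
    ℚΣ.sum (λ t → weight t ℚ.* ℚΣ.sum (λ j → stoich j t ℚ.* δ j))
      ≡⟨ ∑-*-∑-comm ℚ-commutativeSemiring weight stoich δ ⟩
    ℚΣ.sum (λ j → ℚΣ.sum (λ t → weight t ℚ.* stoich j t) ℚ.* δ j)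
      ≡⟨ sum-supported-at (CommutativeSemiring.+-commutativeMonoid ℚ-commutativeSemiring) _ i off-i ⟩
    ℚΣ.sum (λ t → weight t ℚ.* stoich i t) ℚ.* δ i                   ≡⟨ cong (ℚ._* δ i) weight-stoich-at ⟩
    excess ℚ.* δ i                                                    ≡⟨ termCoeff-scale excess μᵢ μ ⟨
    termCoeff (excess , μᵢ) μ                                         ≡⟨ coeff-singleton (excess , μᵢ) μ ⟨
    coeff K μ                                                         ∎
    where
    open ≡-Reasoning
    μᵢ : Mono (ℕ.suc m) n
    μᵢ = mono (unitV (Fin.suc i)) (reactant N i)
    δ : Fin m → ℚ
    δ j = termCoeff (1ℚ , mono (unitV (Fin.suc j)) (reactant N j)) μ
    off-i : ∀ j → j ≢ i → ℚΣ.sum (λ t → weight t ℚ.* stoich j t) ℚ.* δ j ≡ 0ℚ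
    off-i j j≢i = trans (cong (ℚ._* δ j) (weight-stoich-off j j≢i)) (ℚP.*-zeroˡ (δ j))

  coeff-ssN′ : ∀ s μ → coeff (ssN' N i s) μ ≡ coeff (ssN N s) μ ℚ.+ (ℚ.- y s) ℚ.* coeff z μ
  coeff-ssN′ s μ = begin
    coeff (ssN' N i s) μ                                            ≡⟨ coeff-ΣP reaction′ μ ⟩
    coeff (outflow ∷ []) μ ℚ.+ ℚΣ.sum (λ j → coeff (reaction j) μ)  ≡⟨ cong (coeff (outflow ∷ []) μ ℚ.+_) (coeff-ΣP reaction μ) ⟨
    coeff (outflow ∷ []) μ ℚ.+ coeff (ssN N s) μ                    ≡⟨ cong (ℚ._+ coeff (ssN N s) μ) outflow-coeff ⟩
    (ℚ.- y s) ℚ.* coeff z μ ℚ.+ coeff (ssN N s) μ                   ≡⟨ ℚP.+-comm ((ℚ.- y s) ℚ.* coeff z μ) (coeff (ssN N s) μ) ⟩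
    coeff (ssN N s) μ ℚ.+ (ℚ.- y s) ℚ.* coeff z μ                   ∎
    where
    open ≡-Reasoning
    X : Mono (ℕ.suc m) n
    X = mono (unitV Fin.zero) (reactant N i)
    outflow : ℚ × Mono (ℕ.suc m) n
    outflow = (ℕtoℚ (lookup (zeroC {n}) s) ℚ.- y s , X)
    reaction : Fin m → Poly (ℕ.suc m) n
    reaction j = (stoich j s , mono (unitV (Fin.suc j)) (reactant N j)) ∷ []
    reaction′ : Fin (ℕ.suc m) → Poly (ℕ.suc m) n
    reaction′ j = (Degrees.stoich (addOutflow N i) j s , mono (unitV j) (reactant (addOutflow N i) j)) ∷ []
    outflow-coeff : coeff (outflow ∷ []) μ ≡ (ℚ.- y s) ℚ.* coeff z μ
    outflow-coeff = begin
      coeff (outflow ∷ []) μ                                           ≡⟨ coeff-singleton outflow μ ⟩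
      termCoeff outflow μ                                              ≡⟨ termCoeff-scale _ X μ ⟩
      (ℕtoℚ (lookup (zeroC {n}) s) ℚ.- y s) ℚ.* termCoeff (1ℚ , X) μ
        ≡⟨ cong (λ x → (ℕtoℚ x ℚ.- y s) ℚ.* termCoeff (1ℚ , X) μ) (VecP.lookup-replicate s 0) ⟩
      (0ℚ ℚ.- y s) ℚ.* termCoeff (1ℚ , X) μ
        ≡⟨ cong₂ ℚ._*_ (ℚP.+-identityˡ (ℚ.- y s)) (sym (coeff-singleton (1ℚ , X) μ)) ⟩
      (ℚ.- y s) ℚ.* coeff z μ                                          ∎

  ssN′-shift : ∀ s → ssN' N i s ≈P (ssN N s ++ const (ℚ.- y s) *P z)
  ssN′-shift s μ = trans (coeff-ssN′ s μ)
    (sym (trans (coeff-++ (ssN N s) _ μ) (cong (coeff (ssN N s) μ ℚ.+_) (coeff-const-*P (ℚ.- y s) z μ))))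

  ssN-shift : ∀ s → ssN N s ≈P (ssN' N i s ++ const (y s) *P z)
  ssN-shift s μ = sym (begin
    coeff (ssN' N i s ++ const (y s) *P z) μ                               ≡⟨ coeff-++ (ssN' N i s) _ μ ⟩
    coeff (ssN' N i s) μ ℚ.+ coeff (const (y s) *P z) μ                    ≡⟨ cong₂ ℚ._+_ (coeff-ssN′ s μ) (coeff-const-*P (y s) z μ) ⟩
    (coeff (ssN N s) μ ℚ.+ (ℚ.- y s) ℚ.* coeff z μ) ℚ.+ y s ℚ.* coeff z μ
      ≡⟨ solve 3 (λ g y c → (g :+ (:- y) :* c) :+ y :* c := g) refl (coeff (ssN N s) μ) (y s) (coeff z μ) ⟩
    coeff (ssN N s) μ                                                      ∎)
    where
    open ≡-Reasoning
    open +-*-Solver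

  lincomb-ssN′ : lincomb weight (ssN' N i) ≈P K
  lincomb-ssN′ μ = trans (sym (lincomb-shift weight y (ssN' N i) (ssN N) z ssN-shift weight-reactant μ)) (lincomb-ssN μ)

  Cz≈L·lincomb : ∀ (G : Fin n → Poly (ℕ.suc m) n) → lincomb weight G ≈P K → (C *P z) ≈P (L *P lincomb weight G)
  Cz≈L·lincomb G lincomb≈K μ = trans (Cz≈LK μ) (*P-congʳ L K (lincomb weight G) (λ ν → sym (lincomb≈K ν)) μ)

theorem4p6 : ∀ {n m : ℕ} (N : Network n m) → IsNetwork N → Is01 N →
    (i : Fin m) →
    (∀ j → ¬ (reactant N j ≡ reactant N i × product N j ≡ zeroC)) →
    (Er Eb : Multiset n m) →
    AlmostBalanced N Er Eb (inj₂ i) →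
    EdgeNotIn N Er Eb i →
    SameIdeal (ssN' N i) (ssN N)
theorem4p6 N _ N01 i _ Er Eb bal Eᵢ∉E p =
    InIdeal-shift (ssN N) (ssN' N i) (const ∘ weight) (λ s → const (ℚ.- y s)) z C L C-preservesDenominators
      ssN′-shift (Cz≈L·lincomb (ssN N) lincomb-ssN) p
  , InIdeal-shift (ssN' N i) (ssN N) (const ∘ weight) (const ∘ y) z C L C-preservesDenominators
      ssN-shift (Cz≈L·lincomb (ssN' N i) lincomb-ssN′) p
  where open Balance N N01 i Er Eb bal Eᵢ∉E
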